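{- Let $\Gamma=\Gamma(\alpha,\omega)$ be a lattice path polymatroid and let $\mu$ be a monomial such that the symmetric exchange graph $\mathcal{G}(\mu)$ is nonempty. Then $\mathcal{G}(\mu)$ has exactly one thin vertex.
   Context: Fix integers $n,r>0$. A lattice path is a sequence of unit north/east steps from the origin to $(n,r)$. Write $\sigma\succeq\tau$ if for all $i\le n$ the $i$-th east step of $\sigma$ lies on or above the $i$-th east step of $\tau$. $m(\sigma)$ is the monomial in $x_0,x_1,\ldots$ in which the degree of $x_i$ is the number of north steps of $\sigma$ along $x=i$. Fix lattice paths $\alpha\succeq\omega$; $\Gamma(\alpha,\omega)$ is the discrete polymatroid whose bases are the $m(\sigma)$ with $\alpha\succeq\sigma\succeq\omega$ (paths identified with their monomials). Bases $\frac{x_j}{x_i}m$ and $\frac{x_i}{x_j}m'$ (when both are bases, with $\deg_{x_i}m>\deg_{x_i}m'$, $\deg_{x_j}m<\deg_{x_j}m'$) are obtained from bases $m,m'$ by a symmetric exchange. For a monomial $\mu$ of degree $>r$, $\mathcal{G}(\mu)$ is the graph whose vertices are the collections (multisets) $V=\{\sigma_1,\ldots,\sigma_t\}$ of bases with $m(\sigma_1)\cdots m(\sigma_t)=\mu$, with $V,W$ adjacent when $W$ arises from $V$ by a symmetric exchange between two of its bases. A vertex $V$ is thin if (1) any two paths in $V$ are comparable under $\succeq$, and (2) for each $i$, the $i$-th east steps of any two paths in $V$ are at most a unit length apart. -}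

module Defs where

open import Data.Nat using (ℕ; zero; suc; _≤_; _<_)
open import Data.List using (List; []; _∷_; concatMap; length)
open import Data.List.Membership.Propositional using (_∈_)
open import Data.List.Relation.Unary.All using (All)
open import Data.List.Relation.Binary.Pointwise using (Pointwise)
open import Data.List.Relation.Binary.Permutation.Propositional using (_↭_)
open import Data.Product using (_×_; Σ; ∃)
open import Data.Sum using (_⊎_)
open import Relation.Binary.PropositionalEquality using (_≡_)

data Step : Set where
  N E : Step

#N : List Step → ℕ
#N [] = 0
#N (N ∷ s) = suc (#N s)
#N (E ∷ s) = #N s

#E : List Step → ℕ
#E [] = 0
#E (N ∷ s) = #E s
#E (E ∷ s) = suc (#E s)

IsPath : ℕ → ℕ → List Step → Set
IsPath n r σ = (#E σ ≡ n) × (#N σ ≡ r)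

eastHeights : ℕ → List Step → List ℕ
eastHeights h [] = []
eastHeights h (N ∷ s) = eastHeights (suc h) s
eastHeights h (E ∷ s) = h ∷ eastHeights h s

_⪰_ : List Step → List Step → Set
σ ⪰ τ = Pointwise (λ a b → b ≤ a) (eastHeights 0 σ) (eastHeights 0 τ)

-- The monomial m(σ), as the multiset of variable indices (x_i ↦ i), one
-- entry per north step, recording the x-coordinate i of that north step.
mono' : ℕ → List Step → List ℕ
mono' x [] = []
mono' x (N ∷ s) = x ∷ mono' x s
mono' x (E ∷ s) = mono' (suc x) s

mono : List Step → List ℕ
mono = mono' 0

deg : List ℕ → ℕ
deg = length

IsBasis : ℕ → ℕ → List Step → List Step → List Step → Set
IsBasis n r α ω σ = IsPath n r σ × (α ⪰ σ) × (σ ⪰ ω)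

-- Vertices of the symmetric exchange graph 𝒢(μ): multisets (lists up to
-- permutation) of bases whose product of monomials is μ.
IsVertex : ℕ → ℕ → List Step → List Step → List ℕ → List (List Step) → Set
IsVertex n r α ω μ V = All (IsBasis n r α ω) V × (concatMap mono V ↭ μ)

UnitClose : List Step → List Step → Set
UnitClose σ τ = Pointwise (λ a b → (a ≤ suc b) × (b ≤ suc a)) (eastHeights 0 σ) (eastHeights 0 τ)

Thin : List (List Step) → Set
Thin V = ∀ {σ τ} → σ ∈ V → τ ∈ V → ((σ ⪰ τ) ⊎ (τ ⪰ σ)) × UnitClose σ τ

-- A path to (n, r) is determined by the heights h(0) ≤ … ≤ h(n-1) ≤ r of its east steps, and
-- h(j) is the number of north steps at x ≤ j.  So the paths σ of a vertex V of 𝒢(μ) satisfy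
-- Σ h_σ(j) = S_j, the number of variables of μ of index ≤ j, and |V| = t := deg μ / r.
-- In a thin vertex the paths form a chain whose heights at each j differ by at most one, so the
-- top path has height ⌈S_j / t⌉ for every j; removing it and inducting on t shows that two thin
-- vertices agree.  Conversely the t paths with heights ⌊(S_j + i) / t⌋, i < t, form a thin vertex:
-- by Hermite's identity their heights sum to S_j, which determines the product of their monomials,
-- and they lie between ω and α since t·h_ω(j) ≤ S_j ≤ t·h_α(j) for any vertex.
module Submission where

open import Defs
open import Data.Nat using (ℕ; zero; suc; _+_; _*_; _∸_; _≤_; _<_; z≤n; s≤s; z<s; s≤s⁻¹; _<?_; _/_; NonZero; >-nonZero)
open import Data.Nat.Properties
open import Data.Nat.DivMod using (m<n*o⇒m/o<n; m*n/n≡m; /-monoˡ-≤; m<n⇒m/n≡0; +-distrib-/-∣ʳ; n/n≡1)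
open import Data.Nat.Divisibility using (∣-refl)
open import Data.Nat.ListAction using (sum)
open import Data.Nat.ListAction.Properties using (sum-++; sum-↭)
open import Data.List using (List; []; _∷_; _++_; [_]; length; map; filter; replicate; applyUpTo; concatMap)
open import Data.List.Properties
  using (length-++; filter-++; filter-none; filter-some; filter-accept; filter-reject; length-filter;
         applyUpTo-∷ʳ; map-applyUpTo; length-applyUpTo; ++-identityʳ; ∷-injectiveʳ)
open import Data.List.Membership.Propositional using (_∈_)
open import Data.List.Membership.Propositional.Properties using (∈-∃++; ∈-applyUpTo⁻)
open import Data.List.Relation.Unary.Any using (here; there)
open import Data.List.Relation.Unary.All as All using (All; []; _∷_)
open import Data.List.Relation.Binary.Pointwise using (Pointwise; []; _∷_; Pointwise-≡⇒≡)
open import Data.List.Relation.Binary.Permutation.Propositional using (_↭_; prep; ↭-refl; ↭-sym; ↭-trans)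
open import Data.List.Relation.Binary.Permutation.Propositional.Properties
  using (shift; ↭-length; ∈-resp-↭; All-resp-↭; filter-↭; map⁺)
open import Data.List.Relation.Binary.Sublist.Propositional using (⊆-refl)
open import Data.List.Relation.Binary.Sublist.Propositional.Properties using (filter⁺; length-mono-≤)
open import Data.Product using (_×_; _,_; proj₁; proj₂; ∃; ∃₂)
open import Data.Sum using (_⊎_; inj₁; inj₂)
open import Function using (_∘_; _∘₂_; case_of_)
open import Relation.Binary.Definitions using (Reflexive; Transitive)
open import Relation.Binary.PropositionalEquality using (_≡_; refl; sym; trans; cong; cong₂; subst; subst₂; module ≡-Reasoning)
open import Relation.Nullary using (¬_; yes; no; contradiction)

-- Counting entries below a bound

count< : ℕ → List ℕ → ℕ
count< i xs = length (filter (_<? i) xs)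

count<-++ : ∀ i xs ys → count< i (xs ++ ys) ≡ count< i xs + count< i ys
count<-++ i xs ys = trans (cong length (filter-++ (_<? i) xs ys)) (length-++ (filter (_<? i) xs))

count<-↭ : ∀ i {xs ys} → xs ↭ ys → count< i xs ≡ count< i ys
count<-↭ i p = ↭-length (filter-↭ (_<? i) p)

count<-zero : ∀ xs → count< 0 xs ≡ 0
count<-zero xs = cong length (filter-none (_<? 0) (All.universal (λ _ ()) xs))

count<-≤-length : ∀ i xs → count< i xs ≤ length xs
count<-≤-length i = length-filter (_<? i)

count<-≤-suc : ∀ i xs → count< i xs ≤ count< (suc i) xs
count<-≤-suc i xs = length-mono-≤ (filter⁺ (_<? i) (_<? suc i) (λ { refl → m<n⇒m<1+n }) (⊆-refl {x = xs}))

count<-∷-< : ∀ {i x} xs → x < i → count< i (x ∷ xs) ≡ suc (count< i xs)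
count<-∷-< {i} _ x<i = cong length (filter-accept (_<? i) x<i)

count<-∷-≮ : ∀ {i x} xs → ¬ x < i → count< i (x ∷ xs) ≡ count< i xs
count<-∷-≮ {i} _ x≮i = cong length (filter-reject (_<? i) x≮i)

count<-∷-jump : ∀ x xs → count< x (x ∷ xs) < count< (suc x) (x ∷ xs)
count<-∷-jump x xs = begin-strict
  count< x (x ∷ xs)            ≡⟨ count<-∷-≮ xs (<-irrefl refl) ⟩
  count< x xs                  ≤⟨ count<-≤-suc x xs ⟩
  count< (suc x) xs            <⟨ n<1+n _ ⟩
  suc (count< (suc x) xs)      ≡⟨ count<-∷-< xs (n<1+n x) ⟨
  count< (suc x) (x ∷ xs)      ∎
  where open ≤-Reasoning

count<-∷-cancel : ∀ i x {xs ys} → count< i (x ∷ xs) ≡ count< i (x ∷ ys) → count< i xs ≡ count< i ys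
count<-∷-cancel i x {xs} {ys} eq with x <? i
... | yes x<i = suc-injective (trans (sym (count<-∷-< xs x<i)) (trans eq (count<-∷-< ys x<i)))
... | no x≮i  = trans (sym (count<-∷-≮ xs x≮i)) (trans eq (count<-∷-≮ ys x≮i))

count<-jump⇒∈ : ∀ x ys → count< x ys < count< (suc x) ys → x ∈ ys
count<-jump⇒∈ x (y ∷ ys) jump with y <? x | y <? suc x
... | yes y<x | yes y<1+x = there (count<-jump⇒∈ x ys (s≤s⁻¹
  (subst₂ _<_ (count<-∷-< ys y<x) (count<-∷-< ys y<1+x) jump)))
... | no y≮x  | yes y<1+x = here (≤-antisym (≮⇒≥ y≮x) (s≤s⁻¹ y<1+x))
... | no y≮x  | no y≮1+x  = there (count<-jump⇒∈ x ys
  (subst₂ _<_ (count<-∷-≮ ys y≮x) (count<-∷-≮ ys y≮1+x) jump))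
... | yes y<x | no y≮1+x  = contradiction (m<n⇒m<1+n y<x) y≮1+x

count<-≗⇒↭ : ∀ xs ys → (∀ i → count< i xs ≡ count< i ys) → xs ↭ ys
count<-≗⇒↭ [] [] _ = ↭-refl
count<-≗⇒↭ [] (y ∷ ys) eq = contradiction (eq (suc y)) (<⇒≢ (filter-some (_<? suc y) (here (n<1+n y))))
count<-≗⇒↭ (x ∷ xs) ys eq
  with as , bs , refl ← ∈-∃++ (count<-jump⇒∈ x ys (subst₂ _<_ (eq x) (eq (suc x)) (count<-∷-jump x xs)))
  = ↭-trans (prep x (count<-≗⇒↭ xs (as ++ bs) eq′)) (↭-sym (shift x as bs))
  where
  eq′ : ∀ i → count< i xs ≡ count< i (as ++ bs)
  eq′ i = count<-∷-cancel i x (trans (eq i) (count<-↭ i (shift x as bs)))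

lookupOr : {A : Set} → A → List A → ℕ → A
lookupOr d []       _       = d
lookupOr d (x ∷ xs) zero    = x
lookupOr d (x ∷ xs) (suc j) = lookupOr d xs j

lookupOr-beyond : ∀ {A : Set} {d : A} xs {j} → length xs ≤ j → lookupOr d xs j ≡ d
lookupOr-beyond []       _         = refl
lookupOr-beyond (x ∷ xs) (s≤s len≤j) = lookupOr-beyond xs len≤j

lookupOr-applyUpTo : ∀ {A : Set} {d : A} f {n j} → j < n → lookupOr d (applyUpTo f n) j ≡ f j
lookupOr-applyUpTo f {j = zero}  (s≤s _)   = refl
lookupOr-applyUpTo f {j = suc j} (s≤s j<n) = lookupOr-applyUpTo (f ∘ suc) j<n

module _ {A B : Set} {R : A → B → Set} {d : A} {e : B} where

  Pointwise⇒lookupOr : ∀ {xs ys} → Pointwise R xs ys →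
                       ∀ j → j < length xs → R (lookupOr d xs j) (lookupOr e ys j)
  Pointwise⇒lookupOr (r ∷ _)  zero    _         = r
  Pointwise⇒lookupOr (_ ∷ rs) (suc j) (s≤s j<n) = Pointwise⇒lookupOr rs j j<n

  lookupOr⇒Pointwise : ∀ xs ys → length xs ≡ length ys →
                       (∀ j → j < length xs → R (lookupOr d xs j) (lookupOr e ys j)) → Pointwise R xs ys
  lookupOr⇒Pointwise []       []       _   _ = []
  lookupOr⇒Pointwise (x ∷ xs) (y ∷ ys) len r =
    r 0 z<s ∷ lookupOr⇒Pointwise xs ys (suc-injective len) (λ j j<n → r (suc j) (s≤s j<n))

-- Lattice paths and the heights of their east steps

#N-++ : ∀ s t → #N (s ++ t) ≡ #N s + #N t
#N-++ []      t = refl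
#N-++ (N ∷ s) t = cong suc (#N-++ s t)
#N-++ (E ∷ s) t = #N-++ s t

#E-++ : ∀ s t → #E (s ++ t) ≡ #E s + #E t
#E-++ []      t = refl
#E-++ (N ∷ s) t = #E-++ s t
#E-++ (E ∷ s) t = cong suc (#E-++ s t)

#N-replicate : ∀ k → #N (replicate k N) ≡ k
#N-replicate zero    = refl
#N-replicate (suc k) = cong suc (#N-replicate k)

#E-replicate : ∀ k → #E (replicate k N) ≡ 0
#E-replicate zero    = refl
#E-replicate (suc k) = #E-replicate k

eastHeights-replicate : ∀ k h s → eastHeights h (replicate k N ++ s) ≡ eastHeights (k + h) s
eastHeights-replicate zero    h s = refl
eastHeights-replicate (suc k) h s = trans (eastHeights-replicate k (suc h) s) (cong (λ h′ → eastHeights h′ s) (+-suc k h))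

length-eastHeights : ∀ h s → length (eastHeights h s) ≡ #E s
length-eastHeights h []      = refl
length-eastHeights h (N ∷ s) = length-eastHeights (suc h) s
length-eastHeights h (E ∷ s) = cong suc (length-eastHeights h s)

length-mono' : ∀ x s → length (mono' x s) ≡ #N s
length-mono' x []      = refl
length-mono' x (N ∷ s) = cong suc (length-mono' x s)
length-mono' x (E ∷ s) = length-mono' (suc x) s

eastHeights-head : ∀ h s {a l} → eastHeights h s ≡ a ∷ l → h ≤ a
eastHeights-head h (N ∷ s) eq   = <⇒≤ (eastHeights-head (suc h) s eq)
eastHeights-head h (E ∷ s) refl = ≤-refl

eastHeights-injective : ∀ h s t → eastHeights h s ≡ eastHeights h t → #N s ≡ #N t → s ≡ t
eastHeights-injective h []      []      _  _  = refl
eastHeights-injective h (N ∷ s) (N ∷ t) eh n  = cong (N ∷_) (eastHeights-injective (suc h) s t eh (suc-injective n))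
eastHeights-injective h (E ∷ s) (E ∷ t) eh n  = cong (E ∷_) (eastHeights-injective h s t (∷-injectiveʳ eh) n)
eastHeights-injective h (N ∷ s) (E ∷ t) eh _  = contradiction (eastHeights-head (suc h) s eh) (<-irrefl refl)
eastHeights-injective h (E ∷ s) (N ∷ t) eh _  = contradiction (eastHeights-head (suc h) t (sym eh)) (<-irrefl refl)
eastHeights-injective h []      (N ∷ t) _  ()
eastHeights-injective h []      (E ∷ t) () _
eastHeights-injective h (N ∷ s) []      _  ()
eastHeights-injective h (E ∷ s) []      () _

-- Past the last east step the height is #N σ, so that height σ j counts the north
-- steps at x ≤ j for every j (count<-mono≡height).
height : List Step → ℕ → ℕ
height σ = lookupOr (#N σ) (eastHeights 0 σ)

count<-mono'-zero : ∀ s {i x} → i ≤ x → count< i (mono' x s) ≡ 0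
count<-mono'-zero []      _   = refl
count<-mono'-zero (N ∷ s) i≤x = trans (count<-∷-≮ (mono' _ s) (≤⇒≯ i≤x)) (count<-mono'-zero s i≤x)
count<-mono'-zero (E ∷ s) i≤x = count<-mono'-zero s (m≤n⇒m≤1+n i≤x)

count<-mono'≡lookupOr : ∀ s x h j → count< (x + suc j) (mono' x s) + h ≡ lookupOr (h + #N s) (eastHeights h s) j
count<-mono'≡lookupOr []      x h j       = sym (+-identityʳ h)
count<-mono'≡lookupOr (N ∷ s) x h j       = begin
  count< (x + suc j) (x ∷ mono' x s) + h      ≡⟨ cong (_+ h) (count<-∷-< (mono' x s) (m<m+n x z<s)) ⟩
  suc (count< (x + suc j) (mono' x s)) + h    ≡⟨ +-suc _ h ⟨
  count< (x + suc j) (mono' x s) + suc h      ≡⟨ count<-mono'≡lookupOr s x (suc h) j ⟩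
  lookupOr (suc h + #N s) (eastHeights (suc h) s) j
    ≡⟨ cong (λ d → lookupOr d (eastHeights (suc h) s) j) (+-suc h (#N s)) ⟨
  lookupOr (h + suc (#N s)) (eastHeights (suc h) s) j ∎
  where open ≡-Reasoning
count<-mono'≡lookupOr (E ∷ s) x h zero    = cong (_+ h) (count<-mono'-zero s (≤-reflexive (+-comm x 1)))
count<-mono'≡lookupOr (E ∷ s) x h (suc j) =
  trans (cong (λ i → count< i (mono' (suc x) s) + h) (+-suc x (suc j))) (count<-mono'≡lookupOr s (suc x) h j)

count<-mono≡height : ∀ σ j → count< (suc j) (mono σ) ≡ height σ j
count<-mono≡height σ j = trans (sym (+-identityʳ _)) (count<-mono'≡lookupOr σ 0 0 j)

staircase : ℕ → (ℕ → ℕ) → ℕ → ℕ → List Step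
staircase r f h zero    = replicate (r ∸ h) N
staircase r f h (suc n) = replicate (f 0 ∸ h) N ++ E ∷ staircase r (f ∘ suc) (f 0) n

module _ (r : ℕ) where

  eastHeights-staircase : ∀ f h n → (∀ j → f j ≤ f (suc j)) → h ≤ f 0 →
                          eastHeights h (staircase r f h n) ≡ applyUpTo f n
  eastHeights-staircase f h zero    _  _      =
    trans (cong (eastHeights h) (sym (++-identityʳ (replicate (r ∸ h) N)))) (eastHeights-replicate (r ∸ h) h [])
  eastHeights-staircase f h (suc n) f↑ h≤f₀ = begin
    eastHeights h (replicate (f 0 ∸ h) N ++ E ∷ rest)  ≡⟨ eastHeights-replicate (f 0 ∸ h) h (E ∷ rest) ⟩
    eastHeights (f 0 ∸ h + h) (E ∷ rest)                ≡⟨ cong (λ a → eastHeights a (E ∷ rest)) (m∸n+n≡m h≤f₀) ⟩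
    f 0 ∷ eastHeights (f 0) rest                        ≡⟨ cong (f 0 ∷_) (eastHeights-staircase (f ∘ suc) (f 0) n (f↑ ∘ suc) (f↑ 0)) ⟩
    applyUpTo f (suc n)                                 ∎
    where
    open ≡-Reasoning
    rest : List Step
    rest = staircase r (f ∘ suc) (f 0) n

  #E-staircase : ∀ f h n → #E (staircase r f h n) ≡ n
  #E-staircase f h zero    = #E-replicate (r ∸ h)
  #E-staircase f h (suc n) = trans (#E-++ (replicate (f 0 ∸ h) N) _)
    (cong₂ _+_ (#E-replicate (f 0 ∸ h)) (cong suc (#E-staircase (f ∘ suc) (f 0) n)))

  #N-staircase : ∀ f h n → (∀ j → f j ≤ f (suc j)) → h ≤ f 0 → (∀ j → f j ≤ r) →
                 #N (staircase r f h n) ≡ r ∸ h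
  #N-staircase f h zero    _  _    _   = #N-replicate (r ∸ h)
  #N-staircase f h (suc n) f↑ h≤f₀ f≤r = begin
    #N (replicate (f 0 ∸ h) N ++ E ∷ staircase r (f ∘ suc) (f 0) n)
      ≡⟨ #N-++ (replicate (f 0 ∸ h) N) _ ⟩
    #N (replicate (f 0 ∸ h) N) + #N (staircase r (f ∘ suc) (f 0) n)
      ≡⟨ cong₂ _+_ (#N-replicate (f 0 ∸ h)) (#N-staircase (f ∘ suc) (f 0) n (f↑ ∘ suc) (f↑ 0) (f≤r ∘ suc)) ⟩
    (f 0 ∸ h) + (r ∸ f 0)      ≡⟨ +-comm (f 0 ∸ h) (r ∸ f 0) ⟩
    (r ∸ f 0) + (f 0 ∸ h)      ≡⟨ +-∸-assoc (r ∸ f 0) h≤f₀ ⟨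
    (r ∸ f 0) + f 0 ∸ h        ≡⟨ cong (_∸ h) (m∸n+n≡m (f≤r 0)) ⟩
    r ∸ h                      ∎
    where open ≡-Reasoning

heightSum : List (List Step) → ℕ → ℕ
heightSum W j = sum (map (λ σ → height σ j) W)

count<-concatMap-mono : ∀ j W → count< (suc j) (concatMap mono W) ≡ heightSum W j
count<-concatMap-mono j []      = refl
count<-concatMap-mono j (σ ∷ W) = trans (count<-++ (suc j) (mono σ) (concatMap mono W))
  (cong₂ _+_ (count<-mono≡height σ j) (count<-concatMap-mono j W))

heightSum-↭ : ∀ j {W V} → W ↭ V → heightSum W j ≡ heightSum V j
heightSum-↭ j p = sum-↭ (map⁺ _ p)

-- Sums and Hermite's identity

module _ {A : Set} (f : A → ℕ) where

  sum-map-≤ : ∀ {a} xs → (∀ {x} → x ∈ xs → f x ≤ a) → sum (map f xs) ≤ length xs * a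
  sum-map-≤ []       _   = z≤n
  sum-map-≤ (x ∷ xs) f≤a = +-mono-≤ (f≤a (here refl)) (sum-map-≤ xs (f≤a ∘ there))

  sum-map-≥ : ∀ {a} xs → (∀ {x} → x ∈ xs → a ≤ f x) → length xs * a ≤ sum (map f xs)
  sum-map-≥ []       _   = z≤n
  sum-map-≥ (x ∷ xs) a≤f = +-mono-≤ (a≤f (here refl)) (sum-map-≥ xs (a≤f ∘ there))

  sum-map-const : ∀ {a} xs → (∀ {x} → x ∈ xs → f x ≡ a) → sum (map f xs) ≡ length xs * a
  sum-map-const xs f≡a = ≤-antisym (sum-map-≤ xs (≤-reflexive ∘ f≡a)) (sum-map-≥ xs (≤-reflexive ∘ sym ∘ f≡a))

  sum-map-suc : ∀ xs → sum (map (suc ∘ f) xs) ≡ sum (map f xs) + length xs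
  sum-map-suc []       = refl
  sum-map-suc (x ∷ xs) = begin
    suc (f x + sum (map (suc ∘ f) xs))        ≡⟨ cong (λ s → suc (f x + s)) (sum-map-suc xs) ⟩
    suc (f x + (sum (map f xs) + length xs))  ≡⟨ cong suc (+-assoc (f x) _ (length xs)) ⟨
    suc (f x + sum (map f xs) + length xs)    ≡⟨ +-suc _ (length xs) ⟨
    f x + sum (map f xs) + suc (length xs)    ∎
    where open ≡-Reasoning

applyUpTo-cong : ∀ {A : Set} {f g : ℕ → A} m → (∀ i → i < m → f i ≡ g i) → applyUpTo f m ≡ applyUpTo g m
applyUpTo-cong zero    _   = refl
applyUpTo-cong (suc m) f≡g = cong₂ _∷_ (f≡g 0 z<s) (applyUpTo-cong m (λ i i<m → f≡g (suc i) (s≤s i<m)))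

sum-applyUpTo-suc : ∀ f m → sum (applyUpTo f (suc m)) ≡ sum (applyUpTo f m) + f m
sum-applyUpTo-suc f m = begin
  sum (applyUpTo f (suc m))        ≡⟨ cong sum (applyUpTo-∷ʳ f m) ⟨
  sum (applyUpTo f m ++ [ f m ])   ≡⟨ sum-++ (applyUpTo f m) [ f m ] ⟩
  sum (applyUpTo f m) + (f m + 0)  ≡⟨ cong (sum (applyUpTo f m) +_) (+-identityʳ (f m)) ⟩
  sum (applyUpTo f m) + f m        ∎
  where open ≡-Reasoning

sum-applyUpTo-zero : ∀ f m → (∀ i → i < m → f i ≡ 0) → sum (applyUpTo f m) ≡ 0
sum-applyUpTo-zero f zero    _   = refl
sum-applyUpTo-zero f (suc m) f≡0 = trans (sum-applyUpTo-suc f m)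
  (cong₂ _+_ (sum-applyUpTo-zero f m (λ i i<m → f≡0 i (m<n⇒m<1+n i<m))) (f≡0 m (n<1+n m)))

module _ (t : ℕ) .{{_ : NonZero t}} where

  [s+i]/t≤a : ∀ {s a i} → s ≤ a * t → i < t → (s + i) / t ≤ a
  [s+i]/t≤a {s} {a} {i} s≤at i<t = s≤s⁻¹ (m<n*o⇒m/o<n (begin-strict
    s + i      <⟨ +-monoʳ-< s i<t ⟩
    s + t      ≤⟨ +-monoˡ-≤ t s≤at ⟩
    a * t + t  ≡⟨ +-comm (a * t) t ⟩
    suc a * t  ∎))
    where open ≤-Reasoning

  a*t≤m⇒a≤m/t : ∀ {a m} → a * t ≤ m → a ≤ m / t
  a*t≤m⇒a≤m/t {a} at≤m = subst (_≤ _) (m*n/n≡m a t) (/-monoˡ-≤ t at≤m)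

  [s+t]/t≡1+s/t : ∀ s → (s + t) / t ≡ suc (s / t)
  [s+t]/t≡1+s/t s = trans (+-distrib-/-∣ʳ s ∣-refl) (trans (cong (s / t +_) (n/n≡1 t)) (+-comm (s / t) 1))

  [s+i]/t≤1+[s+j]/t : ∀ s {i} j → i < t → (s + i) / t ≤ suc ((s + j) / t)
  [s+i]/t≤1+[s+j]/t s {i} j i<t = begin
    (s + i) / t      ≤⟨ /-monoˡ-≤ t (+-monoʳ-≤ s (≤-trans (<⇒≤ i<t) (m≤n+m t j))) ⟩
    (s + (j + t)) / t ≡⟨ cong (_/ t) (+-assoc s j t) ⟨
    (s + j + t) / t  ≡⟨ [s+t]/t≡1+s/t (s + j) ⟩
    suc ((s + j) / t) ∎
    where open ≤-Reasoning

  hermite : ∀ s → sum (applyUpTo (λ i → (s + i) / t) t) ≡ s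
  hermite zero    = sum-applyUpTo-zero (_/ t) t (λ _ i<t → m<n⇒m/n≡0 i<t)
  hermite (suc s) = +-cancelʳ-≡ (s / t) _ _ (begin
    sum (applyUpTo (λ i → (suc s + i) / t) t) + s / t
      ≡⟨ cong₂ _+_ (cong sum (applyUpTo-cong t (λ i _ → cong (_/ t) (sym (+-suc s i))))) (cong (_/ t) (sym (+-identityʳ s))) ⟩
    sum (applyUpTo (g ∘ suc) t) + g 0   ≡⟨ +-comm _ (g 0) ⟩
    sum (applyUpTo g (suc t))           ≡⟨ sum-applyUpTo-suc g t ⟩
    sum (applyUpTo g t) + g t           ≡⟨ cong₂ _+_ (hermite s) ([s+t]/t≡1+s/t s) ⟩
    s + suc (s / t)                     ≡⟨ +-suc s (s / t) ⟩
    suc s + s / t                       ∎)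
    where
    open ≡-Reasoning
    g : ℕ → ℕ
    g i = (s + i) / t

-- Uniqueness of thin families

module _ {A : Set} {_≼_ : A → A → Set} (≼-refl : Reflexive _≼_) (≼-trans : Transitive _≼_) where

  ∃-greatest : ∀ x xs → (∀ {a b} → a ∈ x ∷ xs → b ∈ x ∷ xs → a ≼ b ⊎ b ≼ a) →
               ∃ λ m → m ∈ x ∷ xs × (∀ {a} → a ∈ x ∷ xs → a ≼ m)
  ∃-greatest x []       _     = x , here refl , λ { (here refl) → ≼-refl }
  ∃-greatest x (y ∷ xs) total with m , m∈ , ≼m ← ∃-greatest y xs (λ a∈ b∈ → total (there a∈) (there b∈))
                                 | total (here refl) (there m∈)
  ... | inj₁ x≼m = m , there m∈ , λ { (here refl) → x≼m ; (there a∈) → ≼m a∈ }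
  ... | inj₂ m≼x = x , here refl , λ { (here refl) → ≼-refl ; (there a∈) → ≼-trans (≼m a∈) m≼x }

module Rectangle (n r : ℕ) where

  Path : List Step → Set
  Path = IsPath n r

  length-heights : ∀ σ → Path σ → length (eastHeights 0 σ) ≡ n
  length-heights σ (#E≡n , _) = trans (length-eastHeights 0 σ) #E≡n

  Pointwise⇒heights : ∀ {R : ℕ → ℕ → Set} σ τ → Path σ → Pointwise R (eastHeights 0 σ) (eastHeights 0 τ) →
                      ∀ j → j < n → R (height σ j) (height τ j)
  Pointwise⇒heights σ τ pσ rs j j<n = Pointwise⇒lookupOr rs j (subst (j <_) (sym (length-heights σ pσ)) j<n)

  heights⇒Pointwise : ∀ {R : ℕ → ℕ → Set} σ τ → Path σ → Path τ →
                      (∀ j → j < n → R (height σ j) (height τ j)) → Pointwise R (eastHeights 0 σ) (eastHeights 0 τ)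
  heights⇒Pointwise σ τ pσ pτ rs = lookupOr⇒Pointwise _ _ (trans (length-heights σ pσ) (sym (length-heights τ pτ)))
    (λ j j<len → rs j (subst (j <_) (length-heights σ pσ) j<len))

  height-beyond : ∀ σ {j} → Path σ → n ≤ j → height σ j ≡ r
  height-beyond σ pσ n≤j =
    trans (lookupOr-beyond (eastHeights 0 σ) (subst (_≤ _) (sym (length-heights σ pσ)) n≤j)) (proj₂ pσ)

  heights-injective : ∀ σ τ → Path σ → Path τ → (∀ j → j < n → height σ j ≡ height τ j) → σ ≡ τ
  heights-injective σ τ pσ pτ eq = eastHeights-injective 0 σ τ
    (Pointwise-≡⇒≡ (heights⇒Pointwise σ τ pσ pτ eq)) (trans (proj₂ pσ) (sym (proj₂ pτ)))

  heightSum-beyond : ∀ {W j} → All Path W → n ≤ j → heightSum W j ≡ length W * r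
  heightSum-beyond {W} ps n≤j = sum-map-const _ W (λ {σ} σ∈ → height-beyond σ (All.lookup ps σ∈) n≤j)

  length-concatMap-mono : ∀ {W} → All Path W → length (concatMap mono W) ≡ length W * r
  length-concatMap-mono []                         = refl
  length-concatMap-mono {σ ∷ W} ((_ , #N≡r) ∷ ps) = trans (length-++ (mono σ))
    (cong₂ _+_ (trans (length-mono' 0 σ) #N≡r) (length-concatMap-mono ps))

  _≤ₕ_ : List Step → List Step → Set
  σ ≤ₕ τ = ∀ j → j < n → height σ j ≤ height τ j

  ThinHeights : List (List Step) → Set
  ThinHeights W = ∀ {σ τ} → σ ∈ W → τ ∈ W →
                  (σ ≤ₕ τ ⊎ τ ≤ₕ σ) × (∀ j → j < n → height σ j ≤ suc (height τ j))

  Thin⇒ThinHeights : ∀ {W} → All Path W → Thin W → ThinHeights W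
  Thin⇒ThinHeights ps thin {σ} {τ} σ∈ τ∈ =
    comparable (proj₁ (thin σ∈ τ∈)) , proj₁ ∘₂ Pointwise⇒heights σ τ (All.lookup ps σ∈) (proj₂ (thin σ∈ τ∈))
    where
    comparable : (σ ⪰ τ) ⊎ (τ ⪰ σ) → (σ ≤ₕ τ) ⊎ (τ ≤ₕ σ)
    comparable (inj₁ σ⪰τ) = inj₂ (Pointwise⇒heights σ τ (All.lookup ps σ∈) σ⪰τ)
    comparable (inj₂ τ⪰σ) = inj₁ (Pointwise⇒heights τ σ (All.lookup ps τ∈) τ⪰σ)

  ThinHeights-resp-↭ : ∀ {W V} → W ↭ V → ThinHeights W → ThinHeights V
  ThinHeights-resp-↭ W↭V thin σ∈ τ∈ = thin (∈-resp-↭ (↭-sym W↭V) σ∈) (∈-resp-↭ (↭-sym W↭V) τ∈)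

  ThinHeights-tail : ∀ {σ W} → ThinHeights (σ ∷ W) → ThinHeights W
  ThinHeights-tail thin σ∈ τ∈ = thin (there σ∈) (there τ∈)

  remove-greatest : ∀ {w W} → ThinHeights (w ∷ W) →
                    ∃₂ λ σ W′ → (w ∷ W ↭ σ ∷ W′) × (∀ {τ} → τ ∈ W′ → τ ≤ₕ σ)
  remove-greatest {w} {W} thin
    with σ , σ∈ , greatest ← ∃-greatest (λ _ _ → ≤-refl) (λ p q j j<n → ≤-trans (p j j<n) (q j j<n)) w W
                                          (λ a∈ b∈ → proj₁ (thin a∈ b∈))
    with as , bs , w∷W≡ ← ∈-∃++ σ∈
    = σ , as ++ bs , w∷W↭ , λ τ∈ → greatest (∈-resp-↭ (↭-sym w∷W↭) (there τ∈))
    where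
    w∷W↭ : w ∷ W ↭ σ ∷ as ++ bs
    w∷W↭ = subst (_↭ σ ∷ as ++ bs) (sym w∷W≡) (shift σ as bs)

  -- The other paths lie at most one unit below σ, so the sum S lies in [t·a - k, t·a] and a = ⌈S/t⌉.
  greatest-height≡ceiling : ∀ {σ W} → ThinHeights (σ ∷ W) → (∀ {τ} → τ ∈ W → τ ≤ₕ σ) → ∀ j → j < n →
                            height σ j ≡ (heightSum (σ ∷ W) j + length W) / suc (length W)
  greatest-height≡ceiling {σ} {W} thin greatest j j<n = ≤-antisym
    (a*t≤m⇒a≤m/t (suc k) (begin
      a * suc k               ≡⟨ *-comm a (suc k) ⟩
      a + k * a               ≤⟨ +-monoʳ-≤ a (sum-map-≥ (suc ∘ λ τ → height τ j) W
                                    (λ τ∈ → proj₂ (thin (here refl) (there τ∈)) j j<n)) ⟩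
      a + sum (map (suc ∘ λ τ → height τ j) W)
                              ≡⟨ cong (a +_) (sum-map-suc (λ τ → height τ j) W) ⟩
      a + (heightSum W j + k) ≡⟨ +-assoc a _ k ⟨
      heightSum (σ ∷ W) j + k ∎))
    ([s+i]/t≤a (suc k) (≤-trans (+-monoʳ-≤ a (sum-map-≤ (λ τ → height τ j) W (λ τ∈ → greatest τ∈ j j<n)))
                                (≤-reflexive (*-comm (suc k) a)))
                       (n<1+n k))
    where
    open ≤-Reasoning
    a k : ℕ
    a = height σ j
    k = length W

  thin-unique : ∀ k {W V} → length W ≡ k → length V ≡ k → All Path W → All Path V →
                ThinHeights W → ThinHeights V → (∀ j → j < n → heightSum W j ≡ heightSum V j) → W ↭ V
  thin-unique zero    {[]}     {[]}     _   _   _  _  _  _  _    = ↭-refl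
  thin-unique (suc k) {w ∷ W₀} {v ∷ V₀} |W| |V| pW pV tW tV sums
    with σ , W′ , W↭ , σ-greatest ← remove-greatest tW
       | ρ , V′ , V↭ , ρ-greatest ← remove-greatest tV
    = ↭-trans W↭ (↭-trans (subst (λ ρ′ → σ ∷ W′ ↭ ρ′ ∷ V′) σ≡ρ (prep σ W′↭V′)) (↭-sym V↭))
    where
    pσW′ : All Path (σ ∷ W′)
    pσW′ = All-resp-↭ W↭ pW
    pρV′ : All Path (ρ ∷ V′)
    pρV′ = All-resp-↭ V↭ pV
    tσW′ : ThinHeights (σ ∷ W′)
    tσW′ = ThinHeights-resp-↭ W↭ tW
    tρV′ : ThinHeights (ρ ∷ V′)
    tρV′ = ThinHeights-resp-↭ V↭ tV
    |W′|≡k : length W′ ≡ k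
    |W′|≡k = suc-injective (trans (sym (↭-length W↭)) |W|)
    |V′|≡k : length V′ ≡ k
    |V′|≡k = suc-injective (trans (sym (↭-length V↭)) |V|)
    sums′ : ∀ j → j < n → heightSum (σ ∷ W′) j ≡ heightSum (ρ ∷ V′) j
    sums′ j j<n = trans (heightSum-↭ j (↭-sym W↭)) (trans (sums j j<n) (heightSum-↭ j V↭))
    heights≡ : ∀ j → j < n → height σ j ≡ height ρ j
    heights≡ j j<n = trans (greatest-height≡ceiling tσW′ σ-greatest j j<n)
      (trans (cong₂ (λ S m → (S + m) / suc m) (sums′ j j<n) (trans |W′|≡k (sym |V′|≡k)))
             (sym (greatest-height≡ceiling tρV′ ρ-greatest j j<n)))
    σ≡ρ : σ ≡ ρ
    σ≡ρ = heights-injective σ ρ (All.head pσW′) (All.head pρV′) heights≡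
    W′↭V′ : W′ ↭ V′
    W′↭V′ = thin-unique k |W′|≡k |V′|≡k (All.tail pσW′) (All.tail pρV′) (ThinHeights-tail tσW′) (ThinHeights-tail tρV′)
      (λ j j<n → +-cancelˡ-≡ (height σ j) _ _ (trans (sums′ j j<n) (cong (_+ heightSum V′ j) (sym (heights≡ j j<n)))))

  module Vertices (α ω : List Step) (μ : List ℕ) where

    vertex-paths : ∀ {V} → IsVertex n r α ω μ V → All Path V
    vertex-paths = All.map proj₁ ∘ proj₁

    vertex-degree : ∀ {V} → IsVertex n r α ω μ V → length μ ≡ length V * r
    vertex-degree V-vertex@(_ , V↭μ) = trans (sym (↭-length V↭μ)) (length-concatMap-mono (vertex-paths V-vertex))

    vertex-heightSum : ∀ {V} → IsVertex n r α ω μ V → ∀ j → heightSum V j ≡ count< (suc j) μ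
    vertex-heightSum {V = V} (_ , V↭μ) j = trans (sym (count<-concatMap-mono j V)) (count<-↭ (suc j) V↭μ)

    vertex-heightSum-bounds : ∀ {V} → Path α → Path ω → IsVertex n r α ω μ V → ∀ j → j < n →
                              length V * height ω j ≤ count< (suc j) μ × count< (suc j) μ ≤ length V * height α j
    vertex-heightSum-bounds {V} pα pω V-vertex@(bases , _) j j<n =
      subst (length V * height ω j ≤_) (vertex-heightSum V-vertex j)
        (sum-map-≥ _ V (λ {τ} τ∈ → Pointwise⇒heights τ ω (All.lookup pV τ∈) (proj₂ (proj₂ (All.lookup bases τ∈))) j j<n)) ,
      subst (_≤ length V * height α j) (vertex-heightSum V-vertex j)
        (sum-map-≤ _ V (λ {τ} τ∈ → Pointwise⇒heights α τ pα (proj₁ (proj₂ (All.lookup bases τ∈))) j j<n))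
      where
      pV : All Path V
      pV = vertex-paths V-vertex

    thin-vertices-↭ : ∀ {W V} → 0 < r → IsVertex n r α ω μ W → IsVertex n r α ω μ V → Thin W → Thin V → W ↭ V
    thin-vertices-↭ {W = W} {V} 0<r W-vertex V-vertex W-thin V-thin =
      thin-unique (length V) |W|≡|V| refl pW pV (Thin⇒ThinHeights pW W-thin) (Thin⇒ThinHeights pV V-thin)
        (λ j _ → trans (vertex-heightSum W-vertex j) (sym (vertex-heightSum V-vertex j)))
      where
      pW : All Path W
      pW = vertex-paths W-vertex
      pV : All Path V
      pV = vertex-paths V-vertex
      |W|≡|V| : length W ≡ length V
      |W|≡|V| = *-cancelʳ-≡ (length W) (length V) r {{>-nonZero 0<r}}
        (trans (sym (vertex-degree W-vertex)) (vertex-degree V-vertex))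

-- The thin vertex

module Layers (n r k : ℕ) (μ : List ℕ) (deg-μ : length μ ≡ suc k * r) where
  open Rectangle n r

  level : ℕ → ℕ → ℕ
  level i j = (count< (suc j) μ + i) / suc k

  level-monoʳ : ∀ i j → level i j ≤ level i (suc j)
  level-monoʳ i j = /-monoˡ-≤ (suc k) (+-monoˡ-≤ i (count<-≤-suc (suc j) μ))

  level-monoˡ : ∀ {i i′} j → i ≤ i′ → level i j ≤ level i′ j
  level-monoˡ j i≤i′ = /-monoˡ-≤ (suc k) (+-monoʳ-≤ (count< (suc j) μ) i≤i′)

  level-close : ∀ {i} i′ j → i < suc k → level i j ≤ suc (level i′ j)
  level-close i′ j i<t = [s+i]/t≤1+[s+j]/t (suc k) (count< (suc j) μ) i′ i<t

  layer : ℕ → List Step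
  layer i = staircase r (level i) 0 n

  layers : List (List Step)
  layers = applyUpTo layer (suc k)

  height-layer : ∀ i j → j < n → height (layer i) j ≡ level i j
  height-layer i j j<n = trans (cong (λ hs → lookupOr (#N (layer i)) hs j) (eastHeights-staircase r (level i) 0 n (level-monoʳ i) z≤n))
                               (lookupOr-applyUpTo (level i) j<n)

  layer-path : ∀ {i} → i < suc k → Path (layer i)
  layer-path {i} i<t = #E-staircase r (level i) 0 n ,
    #N-staircase r (level i) 0 n (level-monoʳ i) z≤n
      (λ j → [s+i]/t≤a (suc k) (≤-trans (count<-≤-length (suc j) μ) (≤-reflexive (trans deg-μ (*-comm (suc k) r)))) i<t)

  layers-paths : All Path layers
  layers-paths = All.tabulate λ σ∈ → case ∈-applyUpTo⁻ layer σ∈ of λ where (_ , i<t , refl) → layer-path i<t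

  levels⇒Pointwise : ∀ {R : ℕ → ℕ → Set} {i i′} → i < suc k → i′ < suc k →
                     (∀ j → j < n → R (level i j) (level i′ j)) → Pointwise R (eastHeights 0 (layer i)) (eastHeights 0 (layer i′))
  levels⇒Pointwise {R} {i} {i′} i<t i′<t rs = heights⇒Pointwise (layer i) (layer i′) (layer-path i<t) (layer-path i′<t)
    (λ j j<n → subst₂ R (sym (height-layer i j j<n)) (sym (height-layer i′ j j<n)) (rs j j<n))

  layers-thin : Thin layers
  layers-thin σ∈ τ∈ with i , i<t , refl ← ∈-applyUpTo⁻ layer σ∈ | i′ , i′<t , refl ← ∈-applyUpTo⁻ layer τ∈ =
    comparable (≤-total i i′) ,
    levels⇒Pointwise i<t i′<t (λ j _ → level-close i′ j i<t , level-close i j i′<t)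
    where
    comparable : (i ≤ i′) ⊎ (i′ ≤ i) → (layer i ⪰ layer i′) ⊎ (layer i′ ⪰ layer i)
    comparable (inj₁ i≤i′) = inj₂ (levels⇒Pointwise i′<t i<t (λ j _ → level-monoˡ j i≤i′))
    comparable (inj₂ i′≤i) = inj₁ (levels⇒Pointwise i<t i′<t (λ j _ → level-monoˡ j i′≤i))

  heightSum-layers-< : ∀ j → j < n → heightSum layers j ≡ count< (suc j) μ
  heightSum-layers-< j j<n = begin
    sum (map (λ σ → height σ j) (applyUpTo layer (suc k)))  ≡⟨ cong sum (map-applyUpTo layer _ (suc k)) ⟩
    sum (applyUpTo (λ i → height (layer i) j) (suc k))      ≡⟨ cong sum (applyUpTo-cong (suc k) (λ i _ → height-layer i j j<n)) ⟩
    sum (applyUpTo (λ i → level i j) (suc k))               ≡⟨ hermite (suc k) (count< (suc j) μ) ⟩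
    count< (suc j) μ                                        ∎
    where open ≡-Reasoning

  module _ (α ω : List Step) (pα : Path α) (pω : Path ω) {V} (V-vertex : IsVertex n r α ω μ V) (|V| : length V ≡ suc k) where
    open Vertices α ω μ

    heightSum-layers : ∀ j → heightSum layers j ≡ count< (suc j) μ
    heightSum-layers j with j <? n
    ... | yes j<n = heightSum-layers-< j j<n
    ... | no j≮n  = begin
      heightSum layers j  ≡⟨ heightSum-beyond layers-paths (≮⇒≥ j≮n) ⟩
      length layers * r   ≡⟨ cong (_* r) (trans (length-applyUpTo layer (suc k)) (sym |V|)) ⟩
      length V * r        ≡⟨ heightSum-beyond (vertex-paths V-vertex) (≮⇒≥ j≮n) ⟨
      heightSum V j       ≡⟨ vertex-heightSum V-vertex j ⟩
      count< (suc j) μ    ∎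
      where open ≡-Reasoning

    layer-basis : ∀ {i} → i < suc k → IsBasis n r α ω (layer i)
    layer-basis {i} i<t = layer-path i<t ,
      heights⇒Pointwise α (layer i) pα (layer-path i<t) (λ j j<n → subst (_≤ height α j) (sym (height-layer i j j<n))
        ([s+i]/t≤a (suc k) (≤-trans (proj₂ (bounds j j<n)) (≤-reflexive (*-comm (suc k) (height α j)))) i<t)) ,
      heights⇒Pointwise (layer i) ω (layer-path i<t) pω (λ j j<n → subst (height ω j ≤_) (sym (height-layer i j j<n))
        (a*t≤m⇒a≤m/t (suc k) (≤-trans (≤-reflexive (*-comm (height ω j) (suc k))) (≤-trans (proj₁ (bounds j j<n)) (m≤m+n _ i)))))
      where
      bounds : ∀ j → j < n → suc k * height ω j ≤ count< (suc j) μ × count< (suc j) μ ≤ suc k * height α j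
      bounds j j<n = subst (λ t → t * height ω j ≤ count< (suc j) μ × count< (suc j) μ ≤ t * height α j) |V|
        (vertex-heightSum-bounds pα pω V-vertex j j<n)

    layers-vertex : IsVertex n r α ω μ layers
    layers-vertex = All.tabulate (λ σ∈ → case ∈-applyUpTo⁻ layer σ∈ of λ where (_ , i<t , refl) → layer-basis i<t) ,
                    count<-≗⇒↭ _ μ counts
      where
      counts : ∀ i → count< i (concatMap mono layers) ≡ count< i μ
      counts zero    = trans (count<-zero (concatMap mono layers)) (sym (count<-zero μ))
      counts (suc j) = trans (count<-concatMap-mono j layers) (heightSum-layers j)

lemma3p4 : (n r : ℕ) → 0 < n → 0 < r →
    (α ω : List Step) → IsPath n r α → IsPath n r ω → α ⪰ ω →
    (μ : List ℕ) → r < deg μ →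
    ∃ (IsVertex n r α ω μ) →
    ∃ (λ V → IsVertex n r α ω μ V × Thin V ×
      ((W : List (List Step)) → IsVertex n r α ω μ W → Thin W → W ↭ V))
-- r < deg μ only excludes the empty vertex.
lemma3p4 n r _ _ α ω _ _ _ μ r<deg ([] , _ , []↭μ) = contradiction (subst (r <_) (sym (↭-length []↭μ)) r<deg) n≮0
lemma3p4 n r _ 0<r α ω pα pω _ μ _ (_ ∷ V , V-vertex) =
  layers , thin-vertex , layers-thin , λ W W-vertex W-thin → thin-vertices-↭ 0<r W-vertex thin-vertex W-thin layers-thin
  where
  open Rectangle n r
  open Vertices α ω μ
  open Layers n r (length V) μ (vertex-degree V-vertex)
  thin-vertex : IsVertex n r α ω μ layers
  thin-vertex = layers-vertex α ω pα pω V-vertex refl
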